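{- For every integer $i\ge0$, $\lim_{k\to\infty}\overline{\alpha}(\{1,k,k+2i+1\})=\frac{i+1}{2i+3}$.
   Context: For a finite set $S$ of positive integers, the distance graph $G(S)$ has vertex set $\mathbb{Z}$, with $i,j$ adjacent iff $|i-j|\in S$. For $A\subseteq\mathbb{Z}$, $\delta(A)=\limsup_{N\to\infty}\frac{|A\cap[-N,N]|}{2N+1}$. The independence ratio $\overline{\alpha}(S)$ is the supremum of $\delta(A)$ over all independent sets $A$ of $G(S)$. -}

module Defs where

open import Data.Bool using (Bool; true; false)
open import Data.Nat as ℕ using (ℕ; zero; suc)
open import Data.Integer as ℤ using (ℤ; +_; -[1+_]; ∣_∣)
open import Data.Rational.Unnormalised as ℚ using (ℚᵘ; mkℚᵘ; 0ℚᵘ)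
open import Data.Product using (Σ; _×_)
open import Data.Sum using (_⊎_)
open import Relation.Binary.PropositionalEquality using (_≡_)
open import Relation.Nullary using (¬_)

S : ℕ → ℕ → ℕ → Set
S k i d = (d ≡ 1) ⊎ (d ≡ k) ⊎ (d ≡ k ℕ.+ (2 ℕ.* i ℕ.+ 1))

Subsetℤ : Set
Subsetℤ = ℤ → Bool

-- A is independent in the distance graph G(D): no two members of A are at a
-- distance lying in D.
Independent : (ℕ → Set) → Subsetℤ → Set
Independent D A = ∀ (x y : ℤ) → A x ≡ true → A y ≡ true → ¬ D ∣ x ℤ.- y ∣

ind : Bool → ℕ
ind true  = 1
ind false = 0

-- |A ∩ [-N, N]|
count : Subsetℤ → ℕ → ℕ
count A zero    = ind (A (+ 0))
count A (suc N) = count A N ℕ.+ ind (A (+ suc N)) ℕ.+ ind (A -[1+ N ])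

-- |A ∩ [-N, N]| / (2N + 1)   (mkℚᵘ n d denotes n / (d + 1))
ratio : Subsetℤ → ℕ → ℚᵘ
ratio A N = mkℚᵘ (+ count A N) (2 ℕ.* N)

-- δ(A) ≤ r   (limsup of ratio is at most r)
DensityAtMost : Subsetℤ → ℚᵘ → Set
DensityAtMost A r =
  ∀ (ε : ℚᵘ) → 0ℚᵘ ℚ.< ε →
  Σ ℕ λ N₀ → ∀ N → N₀ ℕ.≤ N → ratio A N ℚ.≤ r ℚ.+ ε

-- δ(A) ≥ r   (limsup of ratio is at least r)
DensityAtLeast : Subsetℤ → ℚᵘ → Set
DensityAtLeast A r =
  ∀ (ε : ℚᵘ) → 0ℚᵘ ℚ.< ε →
  ∀ (N₀ : ℕ) → Σ ℕ λ N → (N₀ ℕ.≤ N) × (r ℚ.- ε ℚ.≤ ratio A N)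

IndRatioAtMost : (ℕ → Set) → ℚᵘ → Set
IndRatioAtMost D r = ∀ (A : Subsetℤ) → Independent D A → DensityAtMost A r

IndRatioAtLeast : (ℕ → Set) → ℚᵘ → Set
IndRatioAtLeast D r =
  ∀ (ε : ℚᵘ) → 0ℚᵘ ℚ.< ε →
  Σ Subsetℤ λ A → Independent D A × DensityAtLeast A (r ℚ.- ε)

IndRatioWithin : (ℕ → Set) → ℚᵘ → ℚᵘ → Set
IndRatioWithin D L ε = IndRatioAtMost D (L ℚ.+ ε) × IndRatioAtLeast D (L ℚ.- ε)

IndRatioLimit : (ℕ → ℕ → Set) → ℚᵘ → Set
IndRatioLimit D L =
  ∀ (ε : ℚᵘ) → 0ℚᵘ ℚ.< ε →
  Σ ℕ λ K → ∀ k → K ℕ.≤ k → IndRatioWithin (D k) L ε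

-- Let A avoid the distances 1, k and c = k + 2i + 1.  Every window
-- {x, …, x + 2i + 1} ∪ {x + c} meets A in at most i + 1 points: 2i + 2 consecutive
-- integers contain at most i + 1 points of A, and if x + c ∈ A then x and x + 2i + 1
-- (at distances c and k from it) are missing, leaving 2i consecutive integers.
-- Averaging over x, each integer is covered 2i + 3 times, so δ(A) ≤ (i + 1)/(2i + 3)
-- for every k.
--
-- For k = n + 1 take the n-periodic set whose residues r satisfy
-- r + 2i + 2 < n and follow the pattern (10)^(i+1) 0 of period 2i + 3.  Modulo n the
-- distances k and k + 2i + 1 become shifts by 1 and by 2i + 2 ≡ −1 (mod 2i + 3), which
-- the pattern forbids, and the density is (i + 1)/(2i + 3) − O(i/n).
module Submission where

open import Data.Bool using (Bool; true; false; _∧_)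
open import Data.Bool.Properties using (T-≡)
open import Data.Empty using (⊥; ⊥-elim)
open import Data.Integer as ℤ using (ℤ; +_; +[1+_]; -[1+_]; +≤+; +<+)
import Data.Integer.DivMod as ℤD
import Data.Integer.Properties as ℤP
import Data.Integer.Tactic.RingSolver as ℤ-Solver
open import Data.Nat
open import Data.Nat.DivMod
open import Data.Nat.Properties
open import Algebra.Properties.CommutativeSemigroup +-commutativeSemigroup
  using (interchange; xy∙z≈xz∙y)
open import Data.Nat.Tactic.RingSolver using (solve-∀)
open import Data.Product using (∃-syntax; _×_; _,_; proj₁; proj₂)
open import Data.Rational.Unnormalised as ℚ using (ℚᵘ; mkℚᵘ; 0ℚᵘ; *≤*; *<*)
import Data.Rational.Unnormalised.Properties as ℚP
open import Data.Sum using (inj₁; inj₂)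
open import Function.Base using (case_of_)
open import Function.Bundles using (Equivalence)
open import Relation.Binary.PropositionalEquality
open import Defs

∑< : ℕ → (ℕ → ℕ) → ℕ
∑< zero    f = 0
∑< (suc n) f = f 0 + ∑< n (λ j → f (suc j))

syntax ∑< n (λ j → e) = ∑[ j < n ] e

∑-cong : ∀ n {f g : ℕ → ℕ} → (∀ j → j < n → f j ≡ g j) → ∑< n f ≡ ∑< n g
∑-cong zero    eq = refl
∑-cong (suc n) eq = cong₂ _+_ (eq 0 z<s) (∑-cong n λ j j<n → eq (suc j) (s<s j<n))

∑-mono-≤ : ∀ n {f g : ℕ → ℕ} → (∀ j → j < n → f j ≤ g j) → ∑< n f ≤ ∑< n g
∑-mono-≤ zero    le = z≤n
∑-mono-≤ (suc n) le = +-mono-≤ (le 0 z<s) (∑-mono-≤ n λ j j<n → le (suc j) (s<s j<n))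

∑-const : ∀ n c → ∑[ j < n ] c ≡ n * c
∑-const zero    c = refl
∑-const (suc n) c = cong (_+_ c) (∑-const n c)

∑-distrib-+ : ∀ n (f g : ℕ → ℕ) → ∑[ j < n ] (f j + g j) ≡ ∑< n f + ∑< n g
∑-distrib-+ zero    f g = refl
∑-distrib-+ (suc n) f g = begin
  f 0 + g 0 + ∑[ j < n ] (f (suc j) + g (suc j))
    ≡⟨ cong (_+_ (f 0 + g 0)) (∑-distrib-+ n _ _) ⟩
  f 0 + g 0 + (∑[ j < n ] f (suc j) + ∑[ j < n ] g (suc j))
    ≡⟨ interchange (f 0) (g 0) _ _ ⟩
  f 0 + ∑[ j < n ] f (suc j) + (g 0 + ∑[ j < n ] g (suc j)) ∎
  where open ≡-Reasoning

∑-comm : ∀ m n (F : ℕ → ℕ → ℕ) → ∑[ i < m ] ∑[ j < n ] F i j ≡ ∑[ j < n ] ∑[ i < m ] F i j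
∑-comm zero    n F = sym (trans (∑-const n 0) (*-zeroʳ n))
∑-comm (suc m) n F = begin
  ∑[ j < n ] F 0 j + ∑[ i < m ] ∑[ j < n ] F (suc i) j
    ≡⟨ cong (_+_ (∑[ j < n ] F 0 j)) (∑-comm m n _) ⟩
  ∑[ j < n ] F 0 j + ∑[ j < n ] ∑[ i < m ] F (suc i) j
    ≡⟨ ∑-distrib-+ n _ _ ⟨
  ∑[ j < n ] (F 0 j + ∑[ i < m ] F (suc i) j) ∎
  where open ≡-Reasoning

∑-++ : ∀ m n f → ∑< (m + n) f ≡ ∑< m f + ∑[ j < n ] f (m + j)
∑-++ zero    n f = refl
∑-++ (suc m) n f = trans (cong (_+_ (f 0)) (∑-++ m n _)) (sym (+-assoc (f 0) _ _))

∑-last : ∀ n f → ∑< (suc n) f ≡ ∑< n f + f n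
∑-last zero    f = +-comm (f 0) 0
∑-last (suc n) f = trans (cong (_+_ (f 0)) (∑-last n _)) (sym (+-assoc (f 0) _ _))

∑-monoˡ-≤ : ∀ f {m n} → m ≤ n → ∑< m f ≤ ∑< n f
∑-monoˡ-≤ f {m} {n} m≤n = begin
  ∑< m f                               ≤⟨ m≤m+n _ _ ⟩
  ∑< m f + ∑[ j < n ∸ m ] f (m + j)    ≡⟨ ∑-++ m (n ∸ m) f ⟨
  ∑< (m + (n ∸ m)) f                   ≡⟨ cong (λ l → ∑< l f) (m+[n∸m]≡n m≤n) ⟩
  ∑< n f                               ∎
  where open ≤-Reasoning

∑-periodic : ∀ q p f → (∀ j → f (p + j) ≡ f j) → ∑< (q * p) f ≡ q * ∑< p f
∑-periodic zero    p f per = refl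
∑-periodic (suc q) p f per = begin
  ∑< (p + q * p) f                     ≡⟨ ∑-++ p (q * p) f ⟩
  ∑< p f + ∑[ j < q * p ] f (p + j)    ≡⟨ cong (_+_ (∑< p f)) (∑-cong (q * p) λ j _ → per j) ⟩
  ∑< p f + ∑< (q * p) f                ≡⟨ cong (_+_ (∑< p f)) (∑-periodic q p f per) ⟩
  ∑< p f + q * ∑< p f                  ∎
  where open ≡-Reasoning

∑-pairs-≤ : ∀ t f → (∀ j → f j + f (suc j) ≤ 1) → ∑< (2 * t) f ≤ t
∑-pairs-≤ zero    f pairs = z≤n
∑-pairs-≤ (suc t) f pairs = begin
  ∑< (2 * suc t) f                          ≡⟨ cong (λ l → ∑< l f) (*-suc 2 t) ⟩
  f 0 + (f 1 + ∑[ j < 2 * t ] f (2 + j))    ≡⟨ +-assoc (f 0) _ _ ⟨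
  f 0 + f 1 + ∑[ j < 2 * t ] f (2 + j)      ≤⟨ +-mono-≤ (pairs 0) (∑-pairs-≤ t _ λ j → pairs (2 + j)) ⟩
  suc t                                     ∎
  where open ≤-Reasoning

∑-shift-≤ : ∀ {c} t len f → t ≤ c → ∑[ j < len ] f (c + j) ≤ ∑[ x < c + len ] f (x + t)
∑-shift-≤ {c} t len f t≤c = begin
  ∑[ j < len ] f (c + j)                                       ≡⟨ ∑-cong len (λ j _ → cong f (split j)) ⟩
  ∑[ j < len ] f (c ∸ t + j + t)                               ≤⟨ m≤n+m _ _ ⟩
  ∑[ x < c ∸ t ] f (x + t) + ∑[ j < len ] f (c ∸ t + j + t)    ≡⟨ ∑-++ (c ∸ t) len _ ⟨
  ∑[ x < c ∸ t + len ] f (x + t)                               ≤⟨ ∑-monoˡ-≤ _ (+-monoˡ-≤ len (m∸n≤m c t)) ⟩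
  ∑[ x < c + len ] f (x + t)                                   ∎
  where
  open ≤-Reasoning
  split : ∀ j → c + j ≡ c ∸ t + j + t
  split j = trans (cong (_+ j) (sym (m∸n+n≡m t≤c))) (xy∙z≈xz∙y (c ∸ t) t j)

-- Double counting: the windows {x + t | t < m} ∪ {x + c}, x < c + len, cover every
-- point of [c, c + len) at least m + 1 times.
window-averaging : ∀ m c a len f → m ≤ suc c →
  (∀ x → ∑[ t < m ] f (x + t) + f (x + c) ≤ a) →
  suc m * ∑[ j < len ] f (c + j) ≤ (c + len) * a
window-averaging m c a len f m≤1+c window = begin
  suc m * G                                                         ≡⟨ +-comm G (m * G) ⟩
  m * G + G                                                         ≡⟨ cong (_+ G) (∑-const m G) ⟨
  ∑[ t < m ] G + G
    ≤⟨ +-mono-≤ (∑-mono-≤ m λ t t<m → ∑-shift-≤ t len f (≤-pred (≤-trans t<m m≤1+c)))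
                (∑-shift-≤ c len f ≤-refl) ⟩
  ∑[ t < m ] ∑[ x < c + len ] f (x + t) + ∑[ x < c + len ] f (x + c)
    ≡⟨ cong (_+ ∑[ x < c + len ] f (x + c)) (∑-comm (c + len) m _) ⟨
  ∑[ x < c + len ] ∑[ t < m ] f (x + t) + ∑[ x < c + len ] f (x + c)
    ≡⟨ ∑-distrib-+ (c + len) _ _ ⟨
  ∑[ x < c + len ] (∑[ t < m ] f (x + t) + f (x + c))               ≤⟨ ∑-mono-≤ (c + len) (λ x _ → window x) ⟩
  ∑[ x < c + len ] a                                                ≡⟨ ∑-const (c + len) a ⟩
  (c + len) * a                                                     ∎
  where
  open ≤-Reasoning
  G : ℕ
  G = ∑[ j < len ] f (c + j)

ind-absent : ∀ {b} → (b ≡ true → ⊥) → ind b ≡ 0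
ind-absent {false} _  = refl
ind-absent {true}  ¬b = ⊥-elim (¬b refl)

ind-disjoint : ∀ {b c} → (b ≡ true → c ≡ true → ⊥) → ind b + ind c ≤ 1
ind-disjoint {true}  {true}  ¬bc = ⊥-elim (¬bc refl refl)
ind-disjoint {true}  {false} _   = ≤-refl
ind-disjoint {false} {true}  _   = ≤-refl
ind-disjoint {false} {false} _   = z≤n

Separated : ℕ → (ℕ → Bool) → Set
Separated d B = ∀ {x y} → x + d ≡ y → B x ≡ true → B y ≡ true → ⊥

separated-adjacent : ∀ {B} → Separated 1 B → ∀ x j → ind (B (x + j)) + ind (B (x + suc j)) ≤ 1
separated-adjacent sep₁ x j = ind-disjoint (sep₁ (trans (+-assoc x j 1) (cong (_+_ x) (+-comm j 1))))

window-≤ : ∀ {k i} {B : ℕ → Bool} →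
  Separated 1 B → Separated k B → Separated (k + (2 * i + 1)) B →
  ∀ x → ∑[ t < 2 + 2 * i ] ind (B (x + t)) + ind (B (x + (k + (2 * i + 1)))) ≤ suc i
window-≤ {k} {i} {B} sep₁ sepₖ sep-far x with B (x + (k + (2 * i + 1))) in far
... | false = begin
  ∑[ t < 2 + 2 * i ] ind (B (x + t)) + 0    ≡⟨ +-identityʳ _ ⟩
  ∑[ t < 2 + 2 * i ] ind (B (x + t))        ≡⟨ cong (λ l → ∑[ t < l ] ind (B (x + t))) (*-suc 2 i) ⟨
  ∑[ t < 2 * suc i ] ind (B (x + t))
    ≤⟨ ∑-pairs-≤ (suc i) (λ t → ind (B (x + t))) (separated-adjacent sep₁ x) ⟩
  suc i                                     ∎
  where open ≤-Reasoning
... | true = begin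
  g 0 + ∑[ t < suc (2 * i) ] g (suc t) + 1
    ≡⟨ cong (λ s → g 0 + s + 1) (∑-last (2 * i) _) ⟩
  g 0 + (∑[ t < 2 * i ] g (suc t) + g (suc (2 * i))) + 1
    ≡⟨ cong₂ (λ u v → u + (∑[ t < 2 * i ] g (suc t) + v) + 1) first-absent last-absent ⟩
  ∑[ t < 2 * i ] g (suc t) + 0 + 1
    ≤⟨ +-monoˡ-≤ 1 (≤-trans (≤-reflexive (+-identityʳ _))
                            (∑-pairs-≤ i _ λ j → separated-adjacent sep₁ x (suc j))) ⟩
  i + 1
    ≡⟨ +-comm i 1 ⟩
  suc i ∎
  where
  open ≤-Reasoning
  g : ℕ → ℕ
  g t = ind (B (x + t))
  first-absent : g 0 ≡ 0
  first-absent = ind-absent λ b → sep-far (cong (_+ (k + (2 * i + 1))) (+-identityʳ x)) b far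
  last-absent : g (suc (2 * i)) ≡ 0
  last-absent = ind-absent λ b → sepₖ (reach x i k) b far
    where
    reach : ∀ x i k → x + (1 + 2 * i) + k ≡ x + (k + (2 * i + 1))
    reach = solve-∀

count-∑ : ∀ A N → count A N ≡ ∑[ j < suc (2 * N) ] ind (A (ℤ.- + N ℤ.+ + j))
count-∑ A zero    = sym (+-identityʳ _)
count-∑ A (suc N) = begin
  count A N + ind (A (+ suc N)) + ind (A -[1+ N ])
    ≡⟨ +-comm _ (ind (A -[1+ N ])) ⟩
  ind (A -[1+ N ]) + (count A N + ind (A (+ suc N)))
    ≡⟨ cong₂ (λ u v → ind (A u) + v) (sym (ℤP.+-identityʳ -[1+ N ]))
             (cong₂ _+_ (count-∑ A N) (cong (λ u → ind (A u)) (sym right-end))) ⟩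
  h (suc N) 0 + (∑< (suc (2 * N)) (h N) + h N (suc (2 * N)))
    ≡⟨ cong (_+_ (h (suc N) 0)) (∑-last (suc (2 * N)) (h N)) ⟨
  h (suc N) 0 + ∑< (2 + 2 * N) (h N)
    ≡⟨ cong (_+_ (h (suc N) 0)) (∑-cong (2 + 2 * N) λ j _ → cong (λ u → ind (A u)) (sym (step (+ N) (+ j)))) ⟩
  ∑< (3 + 2 * N) (h (suc N))
    ≡⟨ cong (λ l → ∑< (suc l) (h (suc N))) (*-suc 2 N) ⟨
  ∑< (suc (2 * suc N)) (h (suc N)) ∎
  where
  open ≡-Reasoning
  h : ℕ → ℕ → ℕ
  h N j = ind (A (ℤ.- + N ℤ.+ + j))
  step : ∀ (N j : ℤ) → ℤ.- (+ 1 ℤ.+ N) ℤ.+ (+ 1 ℤ.+ j) ≡ ℤ.- N ℤ.+ j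
  step = ℤ-Solver.solve-∀
  end : ∀ (N : ℤ) → ℤ.- N ℤ.+ (+ 1 ℤ.+ + 2 ℤ.* N) ≡ + 1 ℤ.+ N
  end = ℤ-Solver.solve-∀
  right-end : ℤ.- + N ℤ.+ + suc (2 * N) ≡ + suc N
  right-end = trans (cong (λ u → ℤ.- + N ℤ.+ (+ 1 ℤ.+ u)) (ℤP.pos-* 2 N)) (end (+ N))

∣-∣-shift : ∀ (z : ℤ) x d → ℤ.∣ (z ℤ.+ + x) ℤ.- (z ℤ.+ + (x + d)) ∣ ≡ d
∣-∣-shift z x d = trans (cong ℤ.∣_∣ (difference z (+ x) (+ d))) (ℤP.∣-i∣≡∣i∣ (+ d))
  where
  difference : ∀ (z x d : ℤ) → (z ℤ.+ x) ℤ.- (z ℤ.+ (x ℤ.+ d)) ≡ ℤ.- d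
  difference = ℤ-Solver.solve-∀

independent⇒separated : ∀ {D A d} → Independent D A → D d → ∀ z → Separated d (λ j → A (z ℤ.+ + j))
independent⇒separated {D} indep Dd z {x} refl ax ay =
  indep _ _ ax ay (subst D (sym (∣-∣-shift z x _)) Dd)

i+∣i-j∣≡j : ∀ {i j} → i ℤ.≤ j → i ℤ.+ + ℤ.∣ i ℤ.- j ∣ ≡ j
i+∣i-j∣≡j {i} {j} i≤j = trans (cong (ℤ._+_ i) (ℤP.∣-∣-≤ i≤j)) (cancel i j)
  where
  cancel : ∀ i j → i ℤ.+ (j ℤ.- i) ≡ j
  cancel = ℤ-Solver.solve-∀

independent-by-shifts : ∀ {D A} → (∀ x d → D d → A x ≡ true → A (x ℤ.+ + d) ≡ true → ⊥) →
  Independent D A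
independent-by-shifts {D} {A} no-shift x y ax ay Dxy with ℤP.≤-total x y
... | inj₁ x≤y = no-shift x _ Dxy ax (subst (λ u → A u ≡ true) (sym (i+∣i-j∣≡j x≤y)) ay)
... | inj₂ y≤x = no-shift y _ (subst D (ℤP.∣i-j∣≡∣j-i∣ x y) Dxy) ay
                   (subst (λ u → A u ≡ true) (sym (i+∣i-j∣≡j y≤x)) ax)

remainder-unique-ℕ : ∀ {n r r'} t → r < n → r ≡ r' + t * n → r ≡ r'
remainder-unique-ℕ zero                  _   eq   = trans eq (+-identityʳ _)
remainder-unique-ℕ {n} {r' = r'} (suc t) r<n refl =
  ⊥-elim (<⇒≱ r<n (≤-trans (m≤m+n n (t * n)) (m≤n+m _ r')))

remainder-unique-+ : ∀ {n r r'} t → r < n → + r ≡ + r' ℤ.+ + t ℤ.* + n → r ≡ r'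
remainder-unique-+ {n} {r' = r'} t r<n eq =
  remainder-unique-ℕ t r<n (ℤP.+-injective (trans eq (cong (ℤ._+_ (+ r')) (sym (ℤP.pos-* t n)))))

isolate-multiple : ∀ (a b z w N : ℤ) → a ℤ.+ z ℤ.* N ≡ b ℤ.+ w ℤ.* N → a ≡ b ℤ.+ (w ℤ.- z) ℤ.* N
isolate-multiple a b z w N eq =
  trans (cancel a z N) (trans (cong (λ u → u ℤ.- z ℤ.* N) eq) (collect b w z N))
  where
  cancel : ∀ a z N → a ≡ a ℤ.+ z ℤ.* N ℤ.- z ℤ.* N
  cancel = ℤ-Solver.solve-∀
  collect : ∀ b w z N → b ℤ.+ w ℤ.* N ℤ.- z ℤ.* N ≡ b ℤ.+ (w ℤ.- z) ℤ.* N
  collect = ℤ-Solver.solve-∀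

remainder-unique : ∀ {n r r'} (z w : ℤ) → r < n → r' < n →
  + r ℤ.+ z ℤ.* + n ≡ + r' ℤ.+ w ℤ.* + n → r ≡ r'
remainder-unique {n} {r} {r'} z w r<n r'<n eq with w ℤ.- z in w-z
... | + t      = remainder-unique-+ t r<n
                   (trans (isolate-multiple (+ r) (+ r') z w (+ n) eq)
                          (cong (λ d → + r' ℤ.+ d ℤ.* + n) w-z))
... | -[1+ t ] = sym (remainder-unique-+ (suc t) r'<n
                   (trans (isolate-multiple (+ r') (+ r) w z (+ n) (sym eq))
                          (cong (λ d → + r ℤ.+ d ℤ.* + n) z-w)))
  where
  negate : ∀ z w → z ℤ.- w ≡ ℤ.- (w ℤ.- z)
  negate = ℤ-Solver.solve-∀
  z-w : z ℤ.- w ≡ + suc t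
  z-w = trans (negate z w) (cong ℤ.-_ w-z)

module _ {n : ℕ} .{{_ : NonZero n}} where

  %ℕ-unique : ∀ {x r} (z : ℤ) → r < n → x ≡ + r ℤ.+ z ℤ.* + n → x ℤ.%ℕ n ≡ r
  %ℕ-unique {x} z r<n x≡ = remainder-unique (x ℤ./ℕ n) z (ℤD.n%ℕd<d x n) r<n
    (trans (sym (ℤD.a≡a%ℕn+[a/ℕn]*n x n)) x≡)

  %ℕ-+ : ∀ x d → x ℤ.%ℕ n + d < n → (x ℤ.+ + d) ℤ.%ℕ n ≡ x ℤ.%ℕ n + d
  %ℕ-+ x d lt = %ℕ-unique (x ℤ./ℕ n) lt
    (trans (cong (ℤ._+ + d) (ℤD.a≡a%ℕn+[a/ℕn]*n x n))
           (swap (+ (x ℤ.%ℕ n)) (x ℤ./ℕ n ℤ.* + n) (+ d)))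
    where
    swap : ∀ r m d → r ℤ.+ m ℤ.+ d ≡ r ℤ.+ d ℤ.+ m
    swap = ℤ-Solver.solve-∀

  %ℕ-periodic : ∀ x → (x ℤ.+ + n) ℤ.%ℕ n ≡ x ℤ.%ℕ n
  %ℕ-periodic x = %ℕ-unique (x ℤ./ℕ n ℤ.+ + 1) (ℤD.n%ℕd<d x n)
    (trans (cong (ℤ._+ + n) (ℤD.a≡a%ℕn+[a/ℕn]*n x n))
           (next (+ (x ℤ.%ℕ n)) (x ℤ./ℕ n) (+ n)))
    where
    next : ∀ r q n → r ℤ.+ q ℤ.* n ℤ.+ n ≡ r ℤ.+ (q ℤ.+ + 1) ℤ.* n
    next = ℤ-Solver.solve-∀

count-≤ : ∀ {k i A} → Independent (S k i) A → ∀ N →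
  (3 + 2 * i) * count A N ≤ (k + (2 * i + 1) + suc (2 * N)) * suc i
count-≤ {k} {i} {A} indep N = begin
  (3 + 2 * i) * count A N
    ≡⟨ cong ((3 + 2 * i) *_) (count-∑ A N) ⟩
  (3 + 2 * i) * ∑[ j < suc (2 * N) ] ind (A (ℤ.- + N ℤ.+ + j))
    ≡⟨ cong ((3 + 2 * i) *_) (∑-cong (suc (2 * N)) λ j _ → cong (λ u → ind (A u)) (recentre j)) ⟩
  (3 + 2 * i) * ∑[ j < suc (2 * N) ] ind (B (c + j))
    ≤⟨ window-averaging (2 + 2 * i) c (suc i) (suc (2 * N)) (λ j → ind (B j)) short
         (window-≤ (separated (inj₁ refl)) (separated (inj₂ (inj₁ refl))) (separated (inj₂ (inj₂ refl)))) ⟩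
  (c + suc (2 * N)) * suc i ∎
  where
  open ≤-Reasoning
  c : ℕ
  c = k + (2 * i + 1)
  B : ℕ → Bool
  B j = A (ℤ.- + (N + c) ℤ.+ + j)
  separated : ∀ {d} → S k i d → Separated d B
  separated Sd = independent⇒separated indep Sd (ℤ.- + (N + c))
  recentre : ∀ j → ℤ.- + N ℤ.+ + j ≡ ℤ.- + (N + c) ℤ.+ + (c + j)
  recentre j = sym (cancel (+ N) (+ c) (+ j))
    where
    cancel : ∀ (N c j : ℤ) → ℤ.- (N ℤ.+ c) ℤ.+ (c ℤ.+ j) ≡ ℤ.- N ℤ.+ j
    cancel = ℤ-Solver.solve-∀
  short : 2 + 2 * i ≤ suc c
  short = s≤s (≤-trans (≤-reflexive (+-comm 1 (2 * i))) (m≤n+m _ k))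

mkℚᵘ-≤ : ∀ a b c d → a * suc d ≤ c * suc b → mkℚᵘ (+ a) b ℚ.≤ mkℚᵘ (+ c) d
mkℚᵘ-≤ a b c d le = *≤* (subst₂ ℤ._≤_ (ℤP.pos-* a (suc d)) (ℤP.pos-* c (suc b)) (+≤+ le))

mkℚᵘ-+ : ∀ a b c d →
  mkℚᵘ (+ a) b ℚ.+ mkℚᵘ (+ c) d ≡ mkℚᵘ (+ (a * suc d + c * suc b)) (d + b * suc d)
mkℚᵘ-+ a b c d = cong (λ n → mkℚᵘ n (d + b * suc d)) (sym (begin
  + (a * suc d + c * suc b)                ≡⟨ ℤP.pos-+ (a * suc d) (c * suc b) ⟩
  + (a * suc d) ℤ.+ + (c * suc b)          ≡⟨ cong₂ ℤ._+_ (ℤP.pos-* a (suc d)) (ℤP.pos-* c (suc b)) ⟩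
  + a ℤ.* + suc d ℤ.+ + c ℤ.* + suc b      ∎))
  where open ≡-Reasoning

p≤q+r⇒p-r≤q : ∀ {p q r} → p ℚ.≤ q ℚ.+ r → p ℚ.- r ℚ.≤ q
p≤q+r⇒p-r≤q {p} {q} {r} le = ℚP.≤-trans (ℚP.+-monoˡ-≤ (ℚ.- r) le) (ℚP.≤-reflexive cancel)
  where
  cancel : (q ℚ.+ r) ℚ.- r ℚ.≃ q
  cancel = ℚP.≃-trans (ℚP.+-assoc q r (ℚ.- r))
             (ℚP.≃-trans (ℚP.+-congʳ q (ℚP.+-inverseʳ r)) (ℚP.+-identityʳ q))

p≤p+q⁺ : ∀ p {q} → 0ℚᵘ ℚ.< q → p ℚ.≤ p ℚ.+ q
p≤p+q⁺ p {q} q>0 = ℚP.p≤p+q p q {{ℚP.pos⇒nonNeg q {{ℚ.positive q>0}}}}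

p-q≤p : ∀ p {q} → 0ℚᵘ ℚ.< q → p ℚ.- q ℚ.≤ p
p-q≤p p q>0 = p≤q+r⇒p-r≤q (p≤p+q⁺ p q>0)

archimedean : ∀ ε → 0ℚᵘ ℚ.< ε → ∃[ e ] mkℚᵘ (+ 1) e ℚ.≤ ε
archimedean (mkℚᵘ +[1+ t ] d) _ = d , mkℚᵘ-≤ 1 d (suc t) d (*-monoˡ-≤ (suc d) (s≤s (z≤n {t})))
archimedean (mkℚᵘ (+ 0)    d) (*<* (+<+ ()))
archimedean (mkℚᵘ -[1+ t ] d) (*<* ())

densityAtMost-mono : ∀ {A r r'} → r ℚ.≤ r' → DensityAtMost A r → DensityAtMost A r'
densityAtMost-mono r≤r' dens ε ε>0 with dens ε ε>0
... | N₀ , bound = N₀ , λ N N₀≤N → ℚP.≤-trans (bound N N₀≤N) (ℚP.+-monoˡ-≤ ε r≤r')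

densityAtLeast-anti : ∀ {A r r'} → r' ℚ.≤ r → DensityAtLeast A r → DensityAtLeast A r'
densityAtLeast-anti r'≤r dens ε ε>0 N₀ with dens ε ε>0 N₀
... | N , N₀≤N , bound = N , N₀≤N , ℚP.≤-trans (ℚP.+-monoˡ-≤ (ℚ.- ε) r'≤r) bound

densityAtLeast-intro : ∀ {A r} → (∀ N₀ → ∃[ N ] N₀ ≤ N × r ℚ.≤ ratio A N) → DensityAtLeast A r
densityAtLeast-intro {r = r} often ε ε>0 N₀ with often N₀
... | N , N₀≤N , bound = N , N₀≤N , ℚP.≤-trans (p-q≤p r ε>0) bound

indRatioAtMost-mono : ∀ {D r r'} → r ℚ.≤ r' → IndRatioAtMost D r → IndRatioAtMost D r'
indRatioAtMost-mono r≤r' bound A indep = densityAtMost-mono r≤r' (bound A indep)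

indRatioAtLeast-anti : ∀ {D r r'} → r' ℚ.≤ r → IndRatioAtLeast D r → IndRatioAtLeast D r'
indRatioAtLeast-anti r'≤r bound ε ε>0 with bound ε ε>0
... | A , indep , dens = A , indep , densityAtLeast-anti (ℚP.+-monoˡ-≤ (ℚ.- ε) r'≤r) dens

indRatioAtLeast-intro : ∀ {D A r} → Independent D A → DensityAtLeast A r → IndRatioAtLeast D r
indRatioAtLeast-intro {A = A} {r} indep dens ε ε>0 =
  A , indep , densityAtLeast-anti (p-q≤p r ε>0) dens

ρ : ℕ → ℚᵘ
ρ i = mkℚᵘ (+ (i + 1)) (2 * i + 2)

-- cnt / T ≤ a / (1 + p) + 1 / E, with the denominators cleared.
upper-arith : ∀ p a c E T cnt → suc p * cnt ≤ (c + T) * a → c * a * E ≤ T →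
  cnt * (suc p * E) ≤ (a * E + 1 * suc p) * T
upper-arith p a c E T cnt le cE≤T = begin
  cnt * (suc p * E)          ≡⟨ commute cnt p E ⟩
  suc p * cnt * E            ≤⟨ *-monoˡ-≤ E le ⟩
  (c + T) * a * E            ≡⟨ expand c T a E ⟩
  c * a * E + a * E * T      ≤⟨ +-monoˡ-≤ (a * E * T) (≤-trans cE≤T (m≤m+n T (p * T))) ⟩
  suc p * T + a * E * T      ≡⟨ factor p T a E ⟩
  (a * E + 1 * suc p) * T    ∎
  where
  open ≤-Reasoning
  commute : ∀ cnt p E → cnt * ((1 + p) * E) ≡ (1 + p) * cnt * E
  commute = solve-∀
  expand : ∀ c T a E → (c + T) * a * E ≡ c * a * E + a * E * T
  expand = solve-∀
  factor : ∀ p T a E → (1 + p) * T + a * E * T ≡ (a * E + 1 * (1 + p)) * T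
  factor = solve-∀

ratio-≤ : ∀ {k i A} → Independent (S k i) A → ∀ e N → (k + (2 * i + 1)) * (i + 1) * suc e ≤ N →
  ratio A N ℚ.≤ ρ i ℚ.+ mkℚᵘ (+ 1) e
ratio-≤ {k} {i} {A} indep e N N₀≤N rewrite mkℚᵘ-+ (i + 1) (2 * i + 2) 1 e =
  mkℚᵘ-≤ (count A N) (2 * N) _ _
    (upper-arith (2 * i + 2) (i + 1) (k + (2 * i + 1)) (suc e) (suc (2 * N)) (count A N)
      (subst₂ (λ p a → p * count A N ≤ (k + (2 * i + 1) + suc (2 * N)) * a)
         (cong suc (+-comm 2 (2 * i))) (+-comm 1 i) (count-≤ indep N))
      (≤-trans N₀≤N (≤-trans (m≤n*m N 2) (n≤1+n _))))

upper-bound : ∀ k i → IndRatioAtMost (S k i) (ρ i)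
upper-bound k i A indep ε ε>0 with archimedean ε ε>0
... | e , 1/e≤ε = (k + (2 * i + 1)) * (i + 1) * suc e , λ N N₀≤N →
  ℚP.≤-trans (ratio-≤ indep e N N₀≤N) (ℚP.+-monoʳ-≤ (ρ i) 1/e≤ε)

[m+d]%n≡[m%n+d]%n : ∀ m d n .{{_ : NonZero n}} → (m + d) % n ≡ (m % n + d) % n
[m+d]%n≡[m%n+d]%n m d n = begin
  (m + d) % n                ≡⟨ %-distribˡ-+ m d n ⟩
  (m % n + d % n) % n        ≡⟨ cong (λ r → (r + d % n) % n) (m%n%n≡m%n m n) ⟨
  (m % n % n + d % n) % n    ≡⟨ %-distribˡ-+ (m % n) d n ⟨
  (m % n + d) % n            ∎
  where open ≡-Reasoning

[m+d]%n≡m%n+d : ∀ m d n .{{_ : NonZero n}} → m % n + d < n → (m + d) % n ≡ m % n + d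
[m+d]%n≡m%n+d m d n lt = trans ([m+d]%n≡[m%n+d]%n m d n) (m<n⇒m%n≡m lt)

alternating : ℕ → ℕ → Bool
alternating _       0             = true
alternating _       1             = false
alternating zero    (suc (suc _)) = false
alternating (suc i) (suc (suc s)) = alternating i s

alternating-separated : ∀ i → Separated 1 (alternating i)
alternating-separated i       {0}           refl _  ()
alternating-separated i       {1}           refl () _
alternating-separated zero    {suc (suc s)} refl () _
alternating-separated (suc i) {suc (suc s)} refl    = alternating-separated i {s} refl

alternating-≤ : ∀ i {s} → alternating i s ≡ true → s ≤ 2 * i
alternating-≤ i       {0}           _ = z≤n
alternating-≤ i       {1}           ()
alternating-≤ zero    {suc (suc s)} ()
alternating-≤ (suc i) {suc (suc s)} a =
  subst (suc (suc s) ≤_) (sym (*-suc 2 i)) (s≤s (s≤s (alternating-≤ i a)))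

alternating-last : ∀ i → alternating i (2 + 2 * i) ≡ false
alternating-last zero    = refl
alternating-last (suc i) =
  subst (λ s → alternating (suc i) (2 + s) ≡ false) (sym (*-suc 2 i)) (alternating-last i)

alternating-∑ : ∀ i → ∑[ s < 3 + 2 * i ] ind (alternating i s) ≡ suc i
alternating-∑ zero    = refl
alternating-∑ (suc i) =
  subst (λ l → ∑[ s < 3 + l ] ind (alternating (suc i) s) ≡ suc (suc i)) (sym (*-suc 2 i))
        (cong suc (alternating-∑ i))

cyclic : ℕ → ℕ → Bool
cyclic i r = alternating i (r % (3 + 2 * i))

cyclic-separated₁ : ∀ i → Separated 1 (cyclic i)
cyclic-separated₁ i {r} refl a b = alternating-separated i {r % (3 + 2 * i)} refl a
  (subst (λ s → alternating i s ≡ true) ([m+d]%n≡m%n+d r 1 (3 + 2 * i) inside) b)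
  where
  inside : r % (3 + 2 * i) + 1 < 3 + 2 * i
  inside = s≤s (≤-trans (+-monoˡ-≤ 1 (alternating-≤ i a))
                        (≤-trans (≤-reflexive (+-comm (2 * i) 1)) (n≤1+n _)))

cyclic-separated₂ : ∀ i → Separated (2 + 2 * i) (cyclic i)
cyclic-separated₂ i {r} refl a b
  with r % (3 + 2 * i) | [m+d]%n≡[m%n+d]%n r (2 + 2 * i) (3 + 2 * i) | m%n<n r (3 + 2 * i)
... | zero  | wraps | _   =
  case trans (sym (subst (λ s → alternating i s ≡ true) (trans wraps (m<n⇒m%n≡m (n<1+n (2 + 2 * i)))) b))
             (alternating-last i) of λ ()
... | suc s | wraps | s<p =
  alternating-separated i {s} (+-comm s 1) (subst (λ t → alternating i t ≡ true) (trans wraps back) b) a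
  where
  open ≡-Reasoning
  back : (suc s + (2 + 2 * i)) % (3 + 2 * i) ≡ s
  back = begin
    (suc s + (2 + 2 * i)) % (3 + 2 * i)   ≡⟨ cong (_% (3 + 2 * i)) (+-suc s (2 + 2 * i)) ⟨
    (s + (3 + 2 * i)) % (3 + 2 * i)       ≡⟨ [m+n]%n≡m%n s (3 + 2 * i) ⟩
    s % (3 + 2 * i)                       ≡⟨ m<n⇒m%n≡m (<-trans (n<1+n s) s<p) ⟩
    s                                     ∎

cyclic-∑ : ∀ i q → ∑[ r < q * (3 + 2 * i) ] ind (cyclic i r) ≡ q * suc i
cyclic-∑ i q = begin
  ∑[ r < q * (3 + 2 * i) ] ind (cyclic i r)
    ≡⟨ ∑-periodic q (3 + 2 * i) _ (λ j → cong (λ s → ind (alternating i s)) (periodic j)) ⟩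
  q * ∑[ r < 3 + 2 * i ] ind (cyclic i r)
    ≡⟨ cong (q *_) (∑-cong (3 + 2 * i) λ r r<p → cong (λ s → ind (alternating i s)) (m<n⇒m%n≡m r<p)) ⟩
  q * ∑[ s < 3 + 2 * i ] ind (alternating i s)
    ≡⟨ cong (q *_) (alternating-∑ i) ⟩
  q * suc i ∎
  where
  open ≡-Reasoning
  periodic : ∀ j → (3 + 2 * i + j) % (3 + 2 * i) ≡ j % (3 + 2 * i)
  periodic j = trans (cong (_% (3 + 2 * i)) (+-comm (3 + 2 * i) j)) ([m+n]%n≡m%n j (3 + 2 * i))

∧-true⁻ : ∀ {a b} → a ∧ b ≡ true → a ≡ true × b ≡ true
∧-true⁻ {true} {true} refl = refl , refl

-- Residues r with r + w ≥ n are dropped, so that shifts by at most w never wrap around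
-- modulo n.
module PeriodicLift (n w : ℕ) .{{_ : NonZero n}} (Q : ℕ → Bool) where

  P : ℕ → Bool
  P r = (r + w <ᵇ n) ∧ Q r

  A : Subsetℤ
  A x = P (x ℤ.%ℕ n)

  A-periodic : ∀ x → A (x ℤ.+ + n) ≡ A x
  A-periodic x = cong P (%ℕ-periodic x)

  A-separated : ∀ {d} → d ≤ w → Separated d Q → ∀ x → A x ≡ true → A (x ℤ.+ + d) ≡ true → ⊥
  A-separated {d} d≤w sep x ax ax+d = sep {x ℤ.%ℕ n} refl (proj₂ (∧-true⁻ ax))
    (proj₂ (∧-true⁻ (trans (cong P (sym (%ℕ-+ x d fits))) ax+d)))
    where
    fits : x ℤ.%ℕ n + d < n
    fits = ≤-<-trans (+-monoʳ-≤ _ d≤w) (<ᵇ⇒< _ n (Equivalence.from T-≡ (proj₁ (∧-true⁻ ax))))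

  count-≥ : ∀ M → 2 * M * ∑[ r < n ] ind (P r) ≤ count A (M * n)
  count-≥ M = begin
    2 * M * ∑[ r < n ] ind (P r)
      ≡⟨ cong (2 * M *_) (∑-cong n λ j j<n → cong (λ r → ind (P r)) (residue j<n)) ⟨
    2 * M * ∑[ j < n ] f j            ≡⟨ ∑-periodic (2 * M) n f (λ j → cong ind (shift j)) ⟨
    ∑[ j < 2 * M * n ] f j            ≡⟨ cong (λ l → ∑< l f) (*-assoc 2 M n) ⟩
    ∑[ j < 2 * (M * n) ] f j          ≤⟨ ∑-monoˡ-≤ f (n≤1+n (2 * (M * n))) ⟩
    ∑[ j < suc (2 * (M * n)) ] f j    ≡⟨ count-∑ A (M * n) ⟨
    count A (M * n)                   ∎
    where
    open ≤-Reasoning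
    f : ℕ → ℕ
    f j = ind (A (ℤ.- + (M * n) ℤ.+ + j))
    shift : ∀ j → A (ℤ.- + (M * n) ℤ.+ + (n + j)) ≡ A (ℤ.- + (M * n) ℤ.+ + j)
    shift j = trans (cong A (swap (ℤ.- + (M * n)) (+ n) (+ j))) (A-periodic (ℤ.- + (M * n) ℤ.+ + j))
      where
      swap : ∀ a n j → a ℤ.+ (n ℤ.+ j) ≡ a ℤ.+ j ℤ.+ n
      swap = ℤ-Solver.solve-∀
    residue : ∀ {j} → j < n → (ℤ.- + (M * n) ℤ.+ + j) ℤ.%ℕ n ≡ j
    residue {j} j<n = %ℕ-unique (ℤ.- + M) j<n
      (trans (cong (λ u → ℤ.- u ℤ.+ + j) (ℤP.pos-* M n)) (reorder (+ M) (+ n) (+ j)))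
      where
      reorder : ∀ M n j → ℤ.- (M ℤ.* n) ℤ.+ j ≡ j ℤ.+ ℤ.- M ℤ.* n
      reorder = ℤ-Solver.solve-∀

  ∑-≤-∑P : ∀ m → m + w ≤ n → ∑[ r < m ] ind (Q r) ≤ ∑[ r < n ] ind (P r)
  ∑-≤-∑P m m+w≤n = begin
    ∑[ r < m ] ind (Q r)    ≡⟨ ∑-cong m (λ r r<m → cong (λ b → ind (b ∧ Q r)) (fits r<m)) ⟨
    ∑[ r < m ] ind (P r)    ≤⟨ ∑-monoˡ-≤ _ (≤-trans (m≤m+n m w) m+w≤n) ⟩
    ∑[ r < n ] ind (P r)    ∎
    where
    open ≤-Reasoning
    fits : ∀ {r} → r < m → (r + w <ᵇ n) ≡ true
    fits r<m = Equivalence.to T-≡ (<⇒<ᵇ (<-≤-trans (+-monoˡ-< w r<m) m+w≤n))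

quotient-with-margin : ∀ n p .{{_ : NonZero p}} → p ≤ n → ∃[ q ] q * p + p ≤ n × n < q * p + p + p
quotient-with-margin n p p≤n = q , lower , upper
  where
  open ≤-Reasoning
  q : ℕ
  q = (n ∸ p) / p
  lower : q * p + p ≤ n
  lower = begin
    q * p + p    ≤⟨ +-monoˡ-≤ p (m/n*n≤m (n ∸ p) p) ⟩
    n ∸ p + p    ≡⟨ m∸n+n≡m p≤n ⟩
    n            ∎
  upper : n < q * p + p + p
  upper = begin-strict
    n                          ≡⟨ m∸n+n≡m p≤n ⟨
    n ∸ p + p                  ≡⟨ cong (_+ p) (m≡m%n+[m/n]*n (n ∸ p) p) ⟩
    (n ∸ p) % p + q * p + p    <⟨ +-monoˡ-< p (+-monoˡ-< (q * p) (m%n<n (n ∸ p) p)) ⟩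
    p + q * p + p              ≡⟨ cong (_+ p) (+-comm p (q * p)) ⟩
    q * p + p + p              ∎

-- a / p ≤ cnt / T + 1 / E with T = 1 + 2Mn, the denominators cleared.
lower-arith : ∀ a p n c₀ E M cnt → a * (1 + n) ≤ p * (c₀ + 2 * a) → 2 * a * E ≤ n → 1 ≤ M →
  2 * M * c₀ ≤ cnt → a * ((1 + 2 * (M * n)) * E) ≤ (cnt * E + 1 * (1 + 2 * (M * n))) * p
lower-arith a p n c₀ E M cnt a[1+n]≤ 2aE≤n 1≤M 2Mc₀≤cnt = begin
  a * ((1 + 2 * (M * n)) * E)                     ≡⟨ expand a n E M ⟩
  2 * M * E * (a * n) + 1 * (E * a)
    ≤⟨ +-monoʳ-≤ _ (*-monoˡ-≤ (E * a) (≤-trans 1≤M (m≤m+n M (M + 0)))) ⟩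
  2 * M * E * (a * n) + 2 * M * (E * a)           ≡⟨ collect a n E M ⟩
  2 * M * E * (a * (1 + n))                       ≤⟨ *-monoʳ-≤ (2 * M * E) a[1+n]≤ ⟩
  2 * M * E * (p * (c₀ + 2 * a))                  ≡⟨ distribute a p c₀ E M ⟩
  2 * M * c₀ * E * p + 2 * M * p * (2 * a * E)
    ≤⟨ +-mono-≤ (*-monoˡ-≤ p (*-monoˡ-≤ E 2Mc₀≤cnt)) (*-monoʳ-≤ (2 * M * p) 2aE≤n) ⟩
  cnt * E * p + 2 * M * p * n                     ≡⟨ cong (_+_ (cnt * E * p)) (regroup p n M) ⟩
  cnt * E * p + 2 * (M * n) * p                   ≤⟨ +-monoʳ-≤ (cnt * E * p) (m≤n+m _ p) ⟩
  cnt * E * p + (1 + 2 * (M * n)) * p             ≡⟨ factor cnt E p (1 + 2 * (M * n)) ⟩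
  (cnt * E + 1 * (1 + 2 * (M * n))) * p           ∎
  where
  open ≤-Reasoning
  expand : ∀ a n E M → a * ((1 + 2 * (M * n)) * E) ≡ 2 * M * E * (a * n) + 1 * (E * a)
  expand = solve-∀
  collect : ∀ a n E M → 2 * M * E * (a * n) + 2 * M * (E * a) ≡ 2 * M * E * (a * (1 + n))
  collect = solve-∀
  distribute : ∀ a p c₀ E M →
    2 * M * E * (p * (c₀ + 2 * a)) ≡ 2 * M * c₀ * E * p + 2 * M * p * (2 * a * E)
  distribute = solve-∀
  regroup : ∀ p n M → 2 * M * p * n ≡ 2 * (M * n) * p
  regroup = solve-∀
  factor : ∀ c E p T → c * E * p + T * p ≡ (c * E + 1 * T) * p
  factor = solve-∀

module _ (i n : ℕ) .{{_ : NonZero n}} where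

  open PeriodicLift n (2 + 2 * i) (cyclic i)

  lifted-independent : Independent (S (suc n) i) A
  lifted-independent = independent-by-shifts no-shift
    where
    no-shift : ∀ x d → S (suc n) i d → A x ≡ true → A (x ℤ.+ + d) ≡ true → ⊥
    no-shift x _ (inj₁ refl) = A-separated (s≤s z≤n) (cyclic-separated₁ i) x
    no-shift x _ (inj₂ (inj₁ refl)) ax ax+k = A-separated (s≤s z≤n) (cyclic-separated₁ i) x ax
      (trans (sym (trans (cong A (one x (+ n))) (A-periodic (x ℤ.+ + 1)))) ax+k)
      where
      one : ∀ x n → x ℤ.+ (+ 1 ℤ.+ n) ≡ x ℤ.+ + 1 ℤ.+ n
      one = ℤ-Solver.solve-∀
    no-shift x _ (inj₂ (inj₂ refl)) ax ax+c = A-separated ≤-refl (cyclic-separated₂ i) x ax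
      (trans (sym (trans (cong A (far x (+ n) (+ (2 * i)))) (A-periodic (x ℤ.+ + (2 + 2 * i))))) ax+c)
      where
      far : ∀ x n m → x ℤ.+ ((+ 1 ℤ.+ n) ℤ.+ (m ℤ.+ + 1)) ≡ x ℤ.+ (+ 2 ℤ.+ m) ℤ.+ n
      far = ℤ-Solver.solve-∀

  lifted-∑ : 3 + 2 * i ≤ n → suc i * suc n ≤ (3 + 2 * i) * (∑[ r < n ] ind (P r) + 2 * suc i)
  lifted-∑ p≤n with quotient-with-margin n (3 + 2 * i) p≤n
  ... | q , q*p+p≤n , n<q*p+p+p = begin
    suc i * suc n                             ≤⟨ *-monoʳ-≤ (suc i) n<q*p+p+p ⟩
    suc i * (q * p + p + p)                   ≡⟨ rearrange (suc i) q p ⟩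
    p * (q * suc i + 2 * suc i)               ≤⟨ *-monoʳ-≤ p (+-monoˡ-≤ (2 * suc i) periods≤) ⟩
    p * (∑[ r < n ] ind (P r) + 2 * suc i)    ∎
    where
    open ≤-Reasoning
    p : ℕ
    p = 3 + 2 * i
    rearrange : ∀ a q p → a * (q * p + p + p) ≡ p * (q * a + 2 * a)
    rearrange = solve-∀
    periods≤ : q * suc i ≤ ∑[ r < n ] ind (P r)
    periods≤ = begin
      q * suc i                          ≡⟨ cyclic-∑ i q ⟨
      ∑[ r < q * p ] ind (cyclic i r)
        ≤⟨ ∑-≤-∑P (q * p) (≤-trans (+-monoʳ-≤ (q * p) (n≤1+n _)) q*p+p≤n) ⟩
      ∑[ r < n ] ind (P r)               ∎

  ratio-≥ : 3 + 2 * i ≤ n → ∀ e → 2 * (i + 1) * suc e ≤ n → ∀ M → 1 ≤ M →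
    ρ i ℚ.≤ ratio A (M * n) ℚ.+ mkℚᵘ (+ 1) e
  ratio-≥ p≤n e large M 1≤M rewrite mkℚᵘ-+ (count A (M * n)) (2 * (M * n)) 1 e =
    mkℚᵘ-≤ (i + 1) (2 * i + 2) _ _
      (lower-arith (i + 1) (suc (2 * i + 2)) n (∑[ r < n ] ind (P r)) (suc e) M (count A (M * n))
        (subst₂ (λ a p → a * suc n ≤ p * (∑[ r < n ] ind (P r) + 2 * a))
           (+-comm 1 i) (cong suc (+-comm 2 (2 * i))) (lifted-∑ p≤n))
        large 1≤M (count-≥ M))

lower-bound : ∀ i e n → 3 + 2 * i ≤ n → 2 * (i + 1) * suc e ≤ n →
  IndRatioAtLeast (S (suc n) i) (ρ i ℚ.- mkℚᵘ (+ 1) e)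
lower-bound i e n p≤n large =
  indRatioAtLeast-intro {S (suc n) i} {r = ρ i ℚ.- mkℚᵘ (+ 1) e} (lifted-independent i n)
    (densityAtLeast-intro often)
  where
  instance
    n≢0 : NonZero n
    n≢0 = >-nonZero (<-≤-trans z<s p≤n)
  open PeriodicLift n (2 + 2 * i) (cyclic i)
  often : ∀ N₀ → ∃[ N ] N₀ ≤ N × ρ i ℚ.- mkℚᵘ (+ 1) e ℚ.≤ ratio A N
  often N₀ = suc N₀ * n , ≤-trans (n≤1+n N₀) (m≤m*n (suc N₀) n) ,
             p≤q+r⇒p-r≤q {r = mkℚᵘ (+ 1) e} (ratio-≥ i n p≤n e large (suc N₀) z<s)

theorem25 : (i : ℕ) → IndRatioLimit (λ k → S k i) (mkℚᵘ (+ (i + 1)) (2 * i + 2))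
theorem25 i ε ε>0 with archimedean ε ε>0
... | e , 1/e≤ε = suc (2 * (i + 1) * suc e + (3 + 2 * i)) , within
  where
  within : ∀ k → suc (2 * (i + 1) * suc e + (3 + 2 * i)) ≤ k → IndRatioWithin (S k i) (ρ i) ε
  within (suc n) (s≤s K≤n) =
    indRatioAtMost-mono {S (suc n) i} (p≤p+q⁺ (ρ i) ε>0) (upper-bound (suc n) i) ,
    indRatioAtLeast-anti {S (suc n) i} (ℚP.+-monoʳ-≤ (ρ i) (ℚP.neg-mono-≤ 1/e≤ε))
      (lower-bound i e n (≤-trans (m≤n+m _ _) K≤n) (≤-trans (m≤m+n _ _) K≤n))
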